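{- Consider the game "Corner the 2-Queen Dee" described in the context. Let $(a_0,b_0)=(0,0)$ and let $(a_n,b_n)$, $n\ge1$, be the $P$-positions $(x,y)$ with $0<x\le y$, listed so that $a_1<a_2<\cdots$. For $n\ge 0$ put $A_n=\{a_i:0\le i\le n\}$, $B_n=\{b_i:0\le i\le n\}$, $D_n=\{b_i-a_i:0\le i\le n\}$, $S_n=\{a_i+b_i:0\le i\le n\}$. Then for every $n\ge 0$, $$a_{n+1}=\mathrm{mex}(A_n\cup B_n)\quad\text{and}\quad b_{n+1}-a_{n+1}=\mathrm{mex}_2(D_n\cup S_n).$$
   Context: Positions are pairs $(x,y)$ of nonnegative integers. From $(x,y)$ the 2-Queen Dee may move to any position different from $(x,y)$ among: (i) $(x',y)$ with $0\le x'<x$, or $(x,y')$ with $0\le y'<y$; (ii) for each starting point $(u,v)\in\{(x,y),(x-1,y),(x,y-1)\}$ with $u,v\ge0$ (i.e. she may first take one step left or one step down): the diagonal positions $(u-s,v-s)$ with $0\le s\le\min(u,v)$, and additionally reflected positions: if $u<v$, the positions $(t,v-u-t)$ with $0<t\le v-u$; if $u>v$, the positions $(u-v-t,t)$ with $0<t\le u-v$ (after reaching the side of the board diagonally she reflects once and continues along the anti-diagonal of constant coordinate sum). Every move strictly decreases $x+y$. $P$-positions: $(0,0)$ is a $P$-position, and a position is a $P$-position iff it has no move to a $P$-position. For a proper subset $S$ of the nonnegative integers, $\mathrm{mex}(S)$ is the least nonnegative integer not in $S$; for a set $S$ of even nonnegative integers, $\mathrm{mex}_2(S)$ is the least even nonnegative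 integer not in $S$. -}

module Defs where

open import Data.Nat using (ℕ; zero; suc; _+_; _∸_; _≤_; _<_; _⊓_)
open import Data.Nat.Base using (_%_)
open import Data.Bool using (Bool; true; false; not; _∧_)
open import Data.List using (List; []; _∷_; _++_; map; concatMap; upTo; filterᵇ)
open import Data.Bool.ListAction using (any)
open import Data.Product using (_×_; _,_; ∃; ∃-syntax)
open import Data.Sum using (_⊎_)
open import Relation.Binary.PropositionalEquality using (_≡_)
open import Relation.Nullary using (¬_)
import Data.Nat as N

Pos : Set
Pos = ℕ × ℕ

rookMoves : ℕ → ℕ → List Pos
rookMoves x y = map (λ x′ → (x′ , y)) (upTo x) ++ map (λ y′ → (x , y′)) (upTo y)

oneTo : ℕ → List ℕ
oneTo m = map suc (upTo m)

diagMoves : ℕ → ℕ → List Pos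
diagMoves u v = map (λ s → (u ∸ s , v ∸ s)) (upTo (suc (u ⊓ v)))

-- reflected positions: if u < v, (t, v-u-t) for 0 < t ≤ v-u;
-- if u > v, (u-v-t, t) for 0 < t ≤ u-v.  (Truncated subtraction makes the
-- inapplicable list empty automatically; both are empty when u = v.)
reflMoves : ℕ → ℕ → List Pos
reflMoves u v =
  map (λ t → (t , (v ∸ u) ∸ t)) (oneTo (v ∸ u)) ++
  map (λ t → ((u ∸ v) ∸ t , t)) (oneTo (u ∸ v))

starts : ℕ → ℕ → List Pos
starts x y = (x , y) ∷ (left x ++ down y)
  where
  left : ℕ → List Pos
  left zero = []
  left (suc x′) = (x′ , y) ∷ []
  down : ℕ → List Pos
  down zero = []
  down (suc y′) = (x , y′) ∷ []

samePos : Pos → Pos → Bool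
samePos (a , b) (c , d) = (a N.≡ᵇ c) ∧ (b N.≡ᵇ d)

moves : ℕ → ℕ → List Pos
moves x y = filterᵇ (λ p → not (samePos p (x , y)))
  (rookMoves x y ++
   concatMap (λ { (u , v) → diagMoves u v ++ reflMoves u v }) (starts x y))

-- P-position test with fuel; every move strictly decreases x+y, so fuel x+y+1
-- suffices (the fuel-0 case is never reached from isP below).
isPFuel : ℕ → ℕ → ℕ → Bool
isPFuel zero x y = false
isPFuel (suc f) x y = not (any (λ { (x′ , y′) → isPFuel f x′ y′ }) (moves x y))

IsP : ℕ → ℕ → Set
IsP x y = isPFuel (suc (x + y)) x y ≡ true

IsMex : (ℕ → Set) → ℕ → Set
IsMex S m = ¬ S m × (∀ k → k < m → S k)

Even : ℕ → Set
Even k = k % 2 ≡ 0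

IsMex₂ : (ℕ → Set) → ℕ → Set
IsMex₂ S m = Even m × ¬ S m × (∀ k → Even k → k < m → S k)

IsEnumeration : (ℕ → ℕ) → (ℕ → ℕ) → Set
IsEnumeration a b =
  (a 0 ≡ 0 × b 0 ≡ 0)
  × (∀ n → 1 ≤ n → IsP (a n) (b n) × 0 < a n × a n ≤ b n)
  × (∀ x y → IsP x y → 0 < x → x ≤ y → ∃[ n ] (1 ≤ n × a n ≡ x × b n ≡ y))
  × (∀ n → 1 ≤ n → a n < a (suc n))

AB : (ℕ → ℕ) → (ℕ → ℕ) → ℕ → ℕ → Set
AB a b n k = ∃[ i ] (i ≤ n × (k ≡ a i ⊎ k ≡ b i))

DS : (ℕ → ℕ) → (ℕ → ℕ) → ℕ → ℕ → Set
DS a b n k = ∃[ i ] (i ≤ n × (k ≡ b i ∸ a i ⊎ k ≡ a i + b i))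

-- Let (α, β) be the pair given by the mex recursion of the statement. The
-- positions (α i, β i) and (β i, α i) form a kernel of the move graph. No move
-- joins two of them: a rook move would give a position two partners, a
-- diagonal glide keeps y − x (which determines the kernel position), a
-- reflected glide from (α i, β i) lands on coordinate sum β i − α i, which is
-- never a sum α j + β j away from the origin, and a glide launched one step
-- off changes the parity of x + y, which is even on the kernel. Every other
-- position moves into it: if x = α i ≤ y < β i, then y − x or y − x − 1 is an
-- even number below β i − α i, hence lies in D_{i−1} ∪ S_{i−1} and yields a
-- diagonal or reflected glide onto some (α j, β j). So the kernel is the set
-- of P-positions, and any enumeration as in the statement coincides with
-- (α, β): both first coordinates are strictly increasing enumerations of the
-- same set.

module Submission where

open import Defs
open import Data.Nat using (ℕ; suc; _∸_)
open import Data.Product using (_×_)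
open import Data.Nat
  using (zero; _+_; _%_; _⊓_; _≤_; _<_; z≤n; s≤s; z<s; parity)
open import Data.Nat.Properties
import Algebra.Properties.CommutativeSemigroup +-commutativeSemigroup as +-comm
open import Data.Parity.Base using (0ℙ; _⁻¹) renaming (_+_ to _ℙ+_)
import Data.Parity.Properties as ℙ
open import Data.Product using (∃; ∃-syntax; ∃₂; _,_; proj₁; proj₂; swap)
open import Data.Sum using (_⊎_; inj₁; inj₂)
open import Data.List using (List; []; _∷_; _++_; map; upTo; concatMap; foldr)
open import Data.List.Relation.Unary.Any using (Any; here; there; any?)
open import Data.List.Relation.Unary.Any.Properties using (any⁺; any⁻)
open import Data.Bool.ListAction using (any)
open import Data.List.Membership.Propositional using (_∈_; find; lose)
open import Data.List.Membership.Propositional.Properties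
open import Data.Empty using (⊥-elim)
open import Data.Bool using (true; not; T)
open import Data.Bool.Properties using (T-≡; T-not-≡; T-∧; ¬-not)
open import Function using (_∘_; _⇔_; mk⇔; Equivalence)
open import Relation.Binary.PropositionalEquality
open import Relation.Binary.Definitions using (tri<; tri≈; tri>)
open import Relation.Nullary using (¬_; yes; no; contradiction)
open import Relation.Nullary.Decidable using (¬?; _×-dec_; _⊎-dec_; decidable-stable; T?)
open import Data.Nat.DivMod using (m*n%n≡0)
open import Relation.Unary using (Decidable)

private
  variable
    i j k m n u v x y x′ y′ δ : ℕ

Minimal : (ℕ → Set) → ℕ → Set
Minimal P k = P k × (∀ j → j < k → ¬ P j)

module _ {P : ℕ → Set} (P? : Decidable P) where

  minimal-below : ∀ m → (∀ j → j < m → ¬ P j) ⊎ ∃ (Minimal P)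
  minimal-below zero = inj₁ λ _ ()
  minimal-below (suc m) with minimal-below m | P? m
  ... | inj₂ found | _      = inj₂ found
  ... | inj₁ none  | yes pm = inj₂ (m , pm , none)
  ... | inj₁ none  | no ¬pm = inj₁ λ j j<1+m → case (m<1+n⇒m<n∨m≡n j<1+m)
    where
    case : j < m ⊎ j ≡ m → ¬ P j
    case (inj₁ j<m) = none _ j<m
    case (inj₂ refl) = ¬pm

  minimal : P m → ∃ (Minimal P)
  minimal {m} pm with minimal-below (suc m)
  ... | inj₁ none  = contradiction pm (none m ≤-refl)
  ... | inj₂ found = found

module _ {S : ℕ → Set} (S? : Decidable S) where

  mex-exists : ¬ S m → ∃ (IsMex S)
  mex-exists ¬sm with minimal (¬? ∘ S?) ¬sm
  ... | k , ¬sk , below = k , ¬sk , λ j j<k → decidable-stable (S? j) (below j j<k)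

  mex₂-exists : Even m → ¬ S m → ∃ (IsMex₂ S)
  mex₂-exists em ¬sm with minimal (λ k → (k % 2 ≟ 0) ×-dec ¬? (S? k)) (em , ¬sm)
  ... | k , (ek , ¬sk) , below =
    k , ek , ¬sk , λ j ej j<k → decidable-stable (S? j) (λ ¬sj → below j j<k (ej , ¬sj))

StrictlyIncreasing : (ℕ → ℕ) → Set
StrictlyIncreasing f = ∀ n → f n < f (suc n)

module _ {f : ℕ → ℕ} (f-inc : StrictlyIncreasing f) where

  increasing-< : i < j → f i < f j
  increasing-< {j = suc j} i<1+j with m<1+n⇒m<n∨m≡n i<1+j
  ... | inj₁ i<j  = <-trans (increasing-< i<j) (f-inc j)
  ... | inj₂ refl = f-inc j

  increasing-≤ : i ≤ j → f i ≤ f j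
  increasing-≤ i≤j with m≤n⇒m<n∨m≡n i≤j
  ... | inj₁ i<j  = <⇒≤ (increasing-< i<j)
  ... | inj₂ refl = ≤-refl

  increasing-reflects-< : f i < f j → i < j
  increasing-reflects-< fi<fj = ≰⇒> λ j≤i → <⇒≱ fi<fj (increasing-≤ j≤i)

  increasing-injective : f i ≡ f j → i ≡ j
  increasing-injective {i} {j} fi≡fj with <-cmp i j
  ... | tri< i<j _ _ = contradiction fi≡fj (<⇒≢ (increasing-< i<j))
  ... | tri≈ _ i≡j _ = i≡j
  ... | tri> _ _ j<i = contradiction (sym fi≡fj) (<⇒≢ (increasing-< j<i))

  increasing-≥-id : ∀ n → n ≤ f n
  increasing-≥-id zero    = z≤n
  increasing-≥-id (suc n) = ≤-<-trans (increasing-≥-id n) (f-inc n)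

increasing-image⊆⇒≤ : ∀ {f g} → StrictlyIncreasing f → StrictlyIncreasing g →
  (∀ n → ∃[ m ] g m ≡ f n) → ∀ n → g n ≤ f n
increasing-image⊆⇒≤ {f} {g} f-inc g-inc f⊆g zero with f⊆g zero
... | m , gm≡f0 = subst (g 0 ≤_) gm≡f0 (increasing-≤ g-inc z≤n)
increasing-image⊆⇒≤ {f} {g} f-inc g-inc f⊆g (suc n) with f⊆g (suc n)
... | m , gm≡f1+n = subst (g (suc n) ≤_) gm≡f1+n (increasing-≤ g-inc n<m)
  where
  n<m : n < m
  n<m = increasing-reflects-< g-inc (begin-strict
    g n       ≤⟨ increasing-image⊆⇒≤ f-inc g-inc f⊆g n ⟩
    f n       <⟨ f-inc n ⟩
    f (suc n) ≡⟨ gm≡f1+n ⟨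
    g m       ∎)
    where open ≤-Reasoning

increasing-same-image⇒≗ : ∀ {f g} → StrictlyIncreasing f → StrictlyIncreasing g →
  (∀ n → ∃[ m ] g m ≡ f n) → (∀ n → ∃[ m ] f m ≡ g n) → ∀ n → f n ≡ g n
increasing-same-image⇒≗ f-inc g-inc f⊆g g⊆f n =
  ≤-antisym (increasing-image⊆⇒≤ g-inc f-inc g⊆f n) (increasing-image⊆⇒≤ f-inc g-inc f⊆g n)

even⊎odd : ∀ n → Even n ⊎ ∃[ m ] (n ≡ suc m × Even m)
even⊎odd zero          = inj₁ refl
even⊎odd (suc zero)    = inj₂ (0 , refl , refl)
even⊎odd (suc (suc n)) with even⊎odd n
... | inj₁ en              = inj₁ en
... | inj₂ (m , refl , em) = inj₂ (suc (suc m) , refl , em)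

even⇒parity≡0ℙ : ∀ k → Even k → parity k ≡ 0ℙ
even⇒parity≡0ℙ zero          _  = refl
even⇒parity≡0ℙ (suc (suc k)) ek = even⇒parity≡0ℙ k ek

parity-+-double : ∀ m n → parity (m + (n + n)) ≡ parity m
parity-+-double m n = begin
  parity (m + (n + n))             ≡⟨ ℙ.+-homo-+ m (n + n) ⟩
  parity m ℙ+ parity (n + n)       ≡⟨ cong (parity m ℙ+_) (trans (ℙ.+-homo-+ n n) (ℙ.p+p≡0ℙ (parity n))) ⟩
  parity m ℙ+ 0ℙ                   ≡⟨ ℙ.+-identityʳ (parity m) ⟩
  parity m                         ∎
  where open ≡-Reasoning

parity-suc : ∀ n → parity (suc n) ≡ parity n ⁻¹
parity-suc n = trans (sym (ℙ.⁻¹-involutive (parity (suc n)))) (cong _⁻¹ (ℙ.suc-homo-⁻¹ n))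

m+n≤n⇒m≡0 : ∀ m n → m + n ≤ n → m ≡ 0
m+n≤n⇒m≡0 m n m+n≤n = n≤0⇒n≡0 (+-cancelʳ-≤ n m 0 m+n≤n)

+-cancel-shifted : ∀ p q r s → p + (q + r) ≡ (p + s) + q → r ≡ s
+-cancel-shifted p q r s eq =
  +-cancelˡ-≡ (p + q) r s (trans (+-assoc p q r) (trans eq (+-comm.xy∙z≈xz∙y p s q)))

+-cancel-excess : ∀ p q r s → (p + r) + (q + s) ≡ p + q → r + s ≡ 0
+-cancel-excess p q r s eq =
  +-cancelˡ-≡ (p + q) (r + s) 0 (trans (+-comm.interchange p q r s) (trans eq (sym (+-identityʳ (p + q)))))

-- Moves of the 2-Queen Dee

data Launch : ℕ → ℕ → ℕ → ℕ → Set where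
  stay : Launch x y x y
  left : Launch (suc x) y x y
  down : Launch x (suc y) x y

-- Reflected positions from (u, v), u < v, are those with x + y = v - u; the one
-- with x = 0 is also reached diagonally, so it does no harm to include it.
data Glide (u v : ℕ) : ℕ → ℕ → Set where
  diagonal : ∀ s → x + s ≡ u → y + s ≡ v → Glide u v x y
  reflectˡ : x + y + u ≡ v → Glide u v x y
  reflectᵇ : x + y + v ≡ u → Glide u v x y

data Reach (x y : ℕ) : ℕ → ℕ → Set where
  rookˡ : x′ < x → Reach x y x′ y
  rookᵇ : y′ < y → Reach x y x y′
  queen : Launch x y u v → Glide u v x′ y′ → Reach x y x′ y′

Launch-swap : Launch x y u v → Launch y x v u
Launch-swap stay = stay
Launch-swap left = down
Launch-swap down = left

Glide-swap : Glide u v x y → Glide v u y x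
Glide-swap (diagonal s x+s≡u y+s≡v) = diagonal s y+s≡v x+s≡u
Glide-swap {u} {v} {x} {y} (reflectˡ eq) = reflectᵇ (trans (cong (_+ u) (+-comm y x)) eq)
Glide-swap {u} {v} {x} {y} (reflectᵇ eq) = reflectˡ (trans (cong (_+ v) (+-comm y x)) eq)

Reach-swap : Reach x y x′ y′ → Reach y x y′ x′
Reach-swap (rookˡ lt)           = rookᵇ lt
Reach-swap (rookᵇ lt)           = rookˡ lt
Reach-swap (queen launch glide) = queen (Launch-swap launch) (Glide-swap glide)

Launch-≤ : Launch x y u v → u ≤ x × v ≤ y
Launch-≤ stay = ≤-refl , ≤-refl
Launch-≤ left = n≤1+n _ , ≤-refl
Launch-≤ down = ≤-refl , n≤1+n _

≤-≤-≢⇒+< : x′ ≤ x → y′ ≤ y → (x′ , y′) ≢ (x , y) → x′ + y′ < x + y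
≤-≤-≢⇒+< x′≤x y′≤y ne with m≤n⇒m<n∨m≡n x′≤x | m≤n⇒m<n∨m≡n y′≤y
... | inj₁ x′<x | _          = +-mono-<-≤ x′<x y′≤y
... | inj₂ refl | inj₁ y′<y  = +-monoʳ-< _ y′<y
... | inj₂ refl | inj₂ refl  = contradiction refl ne

Reach-decreasing : 0 < x → 0 < y → Reach x y x′ y′ → (x′ , y′) ≢ (x , y) → x′ + y′ < x + y
Reach-decreasing _ _ (rookˡ x′<x) _ = +-monoˡ-< _ x′<x
Reach-decreasing _ _ (rookᵇ y′<y) _ = +-monoʳ-< _ y′<y
Reach-decreasing _ _ (queen launch (diagonal s refl refl)) ne =
  ≤-≤-≢⇒+< (≤-trans (m≤m+n _ s) u≤x) (≤-trans (m≤m+n _ s) v≤y) ne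
  where u≤x = proj₁ (Launch-≤ launch); v≤y = proj₂ (Launch-≤ launch)
Reach-decreasing {x} {y} {x′} {y′} 0<x _ (queen launch (reflectˡ refl)) _ = begin-strict
  x′ + y′             ≤⟨ m≤m+n _ _ ⟩
  x′ + y′ + _         ≤⟨ proj₂ (Launch-≤ launch) ⟩
  y                   <⟨ m<n+m y 0<x ⟩
  x + y               ∎
  where open ≤-Reasoning
Reach-decreasing {x} {y} {x′} {y′} _ 0<y (queen launch (reflectᵇ refl)) _ = begin-strict
  x′ + y′             ≤⟨ m≤m+n _ _ ⟩
  x′ + y′ + _         ≤⟨ proj₁ (Launch-≤ launch) ⟩
  x                   <⟨ m<m+n x 0<y ⟩
  x + y               ∎
  where open ≤-Reasoning

Reach-origin : Reach 0 0 x′ y′ → (x′ , y′) ≡ (0 , 0)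
Reach-origin (queen stay (diagonal s x′+s≡0 y′+s≡0)) = cong₂ _,_ (m+n≡0⇒m≡0 _ x′+s≡0) (m+n≡0⇒m≡0 _ y′+s≡0)
Reach-origin {x′} (queen stay (reflectˡ eq)) = cong₂ _,_ (m+n≡0⇒m≡0 x′ sum≡0) (m+n≡0⇒n≡0 x′ sum≡0)
  where sum≡0 = m+n≡0⇒m≡0 _ eq
Reach-origin {x′} (queen stay (reflectᵇ eq)) = cong₂ _,_ (m+n≡0⇒m≡0 x′ sum≡0) (m+n≡0⇒n≡0 x′ sum≡0)
  where sum≡0 = m+n≡0⇒m≡0 _ eq

Glide-parity : Glide u v x y → parity (u + v) ≡ parity (x + y)
Glide-parity {x = x} {y} (diagonal s refl refl) =
  trans (cong parity (+-comm.interchange x s y s)) (parity-+-double (x + y) s)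
Glide-parity {u} {x = x} {y} (reflectˡ refl) =
  trans (cong parity (+-comm.x∙yz≈y∙xz u (x + y) u)) (parity-+-double (x + y) u)
Glide-parity {v = v} {x} {y} (reflectᵇ refl) =
  trans (cong parity (+-assoc (x + y) v v)) (parity-+-double (x + y) v)

-- The listed moves are the reachable positions

glides : Pos → List Pos
glides (u , v) = diagMoves u v ++ reflMoves u v

∈-oneTo⁻ : k ∈ oneTo m → 0 < k × k ≤ m
∈-oneTo⁻ mem with _ , k∈ , refl ← ∈-map⁻ suc mem = z<s , ∈-upTo⁻ k∈

∈-glides⁻ : (x , y) ∈ glides (u , v) → Glide u v x y
∈-glides⁻ {u = u} {v} mem with ∈-++⁻ (diagMoves u v) mem
... | inj₁ mem′ with s , s∈ , refl ← ∈-map⁻ (λ s → u ∸ s , v ∸ s) {xs = upTo (suc (u ⊓ v))} mem′ =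
  diagonal s (m∸n+n≡m (≤-trans s≤u⊓v (m⊓n≤m u v))) (m∸n+n≡m (≤-trans s≤u⊓v (m⊓n≤n u v)))
  where s≤u⊓v = m<1+n⇒m≤n (∈-upTo⁻ s∈)
... | inj₂ mem′ with ∈-++⁻ (map (λ t → t , (v ∸ u) ∸ t) (oneTo (v ∸ u))) mem′
...   | inj₁ mem″ with t , t∈ , refl ← ∈-map⁻ (λ t → t , (v ∸ u) ∸ t) mem″ =
  reflectˡ (trans (cong (_+ u) (m+[n∸m]≡n t≤v∸u)) (m∸n+n≡m u≤v))
  where
  t≤v∸u = proj₂ (∈-oneTo⁻ t∈)
  u≤v : u ≤ v
  u≤v = <⇒≤ (m∸n≢0⇒n<m (m<n⇒n≢0 (<-≤-trans (proj₁ (∈-oneTo⁻ t∈)) t≤v∸u)))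
...   | inj₂ mem″ with t , t∈ , refl ← ∈-map⁻ (λ t → (u ∸ v) ∸ t , t) mem″ =
  reflectᵇ (trans (cong (_+ v) (m∸n+n≡m t≤u∸v)) (m∸n+n≡m v≤u))
  where
  t≤u∸v = proj₂ (∈-oneTo⁻ t∈)
  v≤u : v ≤ u
  v≤u = <⇒≤ (m∸n≢0⇒n<m (m<n⇒n≢0 (<-≤-trans (proj₁ (∈-oneTo⁻ t∈)) t≤u∸v)))

diagonal-∈-glides : ∀ s → (x , y) ∈ glides (x + s , y + s)
diagonal-∈-glides {x} {y} s =
  ∈-++⁺ˡ (subst (_∈ diagMoves (x + s) (y + s)) (cong₂ _,_ (m+n∸n≡m x s) (m+n∸n≡m y s))
    (∈-map⁺ (λ s′ → (x + s) ∸ s′ , (y + s) ∸ s′) (∈-upTo⁺ (s≤s (⊓-glb (m≤n+m s x) (m≤n+m s y))))))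

∈-reflectedˡ : ∀ w t → w ≡ suc t + y → (suc t , y) ∈ map (λ r → r , w ∸ r) (oneTo w)
∈-reflectedˡ {y} _ t refl =
  subst (λ z → (suc t , z) ∈ map (λ r → r , (suc t + y) ∸ r) (oneTo (suc t + y))) (m+n∸m≡n (suc t) y)
    (∈-map⁺ (λ r → r , (suc t + y) ∸ r) (∈-map⁺ suc (∈-upTo⁺ (s≤s (m≤m+n t y)))))

∈-reflectedᵇ : ∀ w t → w ≡ x + suc t → (x , suc t) ∈ map (λ r → w ∸ r , r) (oneTo w)
∈-reflectedᵇ {x} _ t refl =
  subst (λ z → (z , suc t) ∈ map (λ r → (x + suc t) ∸ r , r) (oneTo (x + suc t))) (m+n∸n≡m x (suc t))
    (∈-map⁺ (λ r → (x + suc t) ∸ r , r) (∈-map⁺ suc (∈-upTo⁺ (m≤n+m (suc t) x))))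

∈-glides⁺ : Glide u v x y → (x , y) ∈ glides (u , v)
∈-glides⁺ (diagonal s refl refl) = diagonal-∈-glides s
∈-glides⁺ {u} {x = zero} (reflectˡ refl) = diagonal-∈-glides u
∈-glides⁺ {u} {v} {suc t} {y} (reflectˡ eq) =
  ∈-++⁺ʳ (diagMoves u v) (∈-++⁺ˡ (∈-reflectedˡ (v ∸ u) t v∸u≡))
  where
  v∸u≡ : v ∸ u ≡ suc t + y
  v∸u≡ = trans (cong (_∸ u) (sym eq)) (m+n∸n≡m (suc t + y) u)
∈-glides⁺ {v = v} {x} {zero} (reflectᵇ refl) =
  subst (λ z → (x , 0) ∈ glides (z + v , v)) (sym (+-identityʳ x)) (diagonal-∈-glides v)
∈-glides⁺ {u} {v} {x} {suc t} (reflectᵇ eq) =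
  ∈-++⁺ʳ (diagMoves u v) (∈-++⁺ʳ (map (λ r → r , (v ∸ u) ∸ r) (oneTo (v ∸ u))) (∈-reflectedᵇ (u ∸ v) t u∸v≡))
  where
  u∸v≡ : u ∸ v ≡ x + suc t
  u∸v≡ = trans (cong (_∸ v) (sym eq)) (m+n∸n≡m (x + suc t) v)

∈-starts⁻ : (u , v) ∈ starts x y → Launch x y u v
∈-starts⁻ {x = zero}  {zero}  (here refl)                 = stay
∈-starts⁻ {x = zero}  {suc y} (here refl)                 = stay
∈-starts⁻ {x = zero}  {suc y} (there (here refl))         = down
∈-starts⁻ {x = suc x} {zero}  (here refl)                 = stay
∈-starts⁻ {x = suc x} {zero}  (there (here refl))         = left
∈-starts⁻ {x = suc x} {suc y} (here refl)                 = stay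
∈-starts⁻ {x = suc x} {suc y} (there (here refl))         = left
∈-starts⁻ {x = suc x} {suc y} (there (there (here refl))) = down

∈-starts⁺ : Launch x y u v → (u , v) ∈ starts x y
∈-starts⁺ {zero}  {zero}  stay = here refl
∈-starts⁺ {zero}  {suc y} stay = here refl
∈-starts⁺ {suc x} {zero}  stay = here refl
∈-starts⁺ {suc x} {suc y} stay = here refl
∈-starts⁺ {y = zero}  left = there (here refl)
∈-starts⁺ {y = suc y} left = there (here refl)
∈-starts⁺ {zero}  down = there (here refl)
∈-starts⁺ {suc x} down = there (there (here refl))

T-samePos⇔≡ : ∀ {p q} → T (samePos p q) ⇔ p ≡ q
T-samePos⇔≡ {a , b} {c , d} = mk⇔
  (λ t → let ta , tb = Equivalence.to T-∧ t in cong₂ _,_ (≡ᵇ⇒≡ a c ta) (≡ᵇ⇒≡ b d tb))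
  (λ { refl → Equivalence.from T-∧ (≡⇒≡ᵇ a a refl , ≡⇒≡ᵇ b b refl) })

∈-rookMoves⁻ : (x′ , y′) ∈ rookMoves x y → Reach x y x′ y′
∈-rookMoves⁻ {x = x} {y} mem with ∈-++⁻ (map (λ x′ → x′ , y) (upTo x)) mem
... | inj₁ mem′ with _ , x′∈ , refl ← ∈-map⁻ (λ x′ → x′ , y) mem′ = rookˡ (∈-upTo⁻ x′∈)
... | inj₂ mem′ with _ , y′∈ , refl ← ∈-map⁻ (λ y′ → x , y′) mem′ = rookᵇ (∈-upTo⁻ y′∈)

moves-sound : (x′ , y′) ∈ moves x y → (x′ , y′) ≢ (x , y) × Reach x y x′ y′
moves-sound {x′} {y′} {x} {y} mem
  with mem′ , fresh ← ∈-filter⁻ (T? ∘ λ p → not (samePos p (x , y)))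
                                  {xs = rookMoves x y ++ concatMap glides (starts x y)} mem =
  (λ same → subst (T ∘ not) (Equivalence.to T-≡ (Equivalence.from T-samePos⇔≡ same)) fresh) , reach mem′
  where
  reach : (x′ , y′) ∈ rookMoves x y ++ concatMap glides (starts x y) → Reach x y x′ y′
  reach mem with ∈-++⁻ (rookMoves x y) mem
  ... | inj₁ rook = ∈-rookMoves⁻ rook
  ... | inj₂ via with _ , launch , glide ← find (∈-concatMap⁻ glides {xs = starts x y} via) =
    queen (∈-starts⁻ launch) (∈-glides⁻ glide)

moves-complete : Reach x y x′ y′ → (x′ , y′) ≢ (x , y) → (x′ , y′) ∈ moves x y
moves-complete {x} {y} {x′} {y′} reach ne =
  ∈-filter⁺ (T? ∘ λ p → not (samePos p (x , y))) {xs = rookMoves x y ++ concatMap glides (starts x y)}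
    (listed reach) (Equivalence.from T-not-≡ (¬-not (ne ∘ Equivalence.to T-samePos⇔≡ ∘ Equivalence.from T-≡)))
  where
  listed : Reach x y x′ y′ → (x′ , y′) ∈ rookMoves x y ++ concatMap glides (starts x y)
  listed (rookˡ x′<x) = ∈-++⁺ˡ (∈-++⁺ˡ (∈-map⁺ (λ x′ → x′ , y) (∈-upTo⁺ x′<x)))
  listed (rookᵇ y′<y) = ∈-++⁺ˡ (∈-++⁺ʳ (map (λ x′ → x′ , y) (upTo x)) (∈-map⁺ (λ y′ → x , y′) (∈-upTo⁺ y′<y)))
  listed (queen launch glide) =
    ∈-++⁺ʳ (rookMoves x y) (∈-concatMap⁺ glides (lose (∈-starts⁺ launch) (∈-glides⁺ glide)))

-- Kernels of the move graph

MovesInto : (ℕ → ℕ → Set) → ℕ → ℕ → Set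
MovesInto K x y = ∃₂ λ x′ y′ → K x′ y′ × Reach x y x′ y′ × x′ + y′ < x + y

MovesInto-swap : ∀ {K : ℕ → ℕ → Set} → (∀ {x y} → K x y → K y x) → MovesInto K x y → MovesInto K y x
MovesInto-swap {x} {y} K-swap (x′ , y′ , k′ , reach , lt) =
  y′ , x′ , K-swap k′ , Reach-swap reach , subst₂ _<_ (+-comm x′ y′) (+-comm x y) lt

-- Moves need not decrease x + y (from (0, v) the reflected glides stay on the
-- line x + y = v), so decrease is only assumed from kernel positions; this is
-- what makes the fuel x + y + 1 in IsP sufficient.
module KernelCharacterisation
  (K : ℕ → ℕ → Set)
  (independent : ∀ {x y x′ y′} → K x y → K x′ y′ → Reach x y x′ y′ → (x′ , y′) ≡ (x , y))
  (absorbing : ∀ x y → K x y ⊎ MovesInto K x y)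
  (decreasing : ∀ {x y x′ y′} → K x y → Reach x y x′ y′ → (x′ , y′) ≢ (x , y) → x′ + y′ < x + y)
  where

  isPFuel⇔K : ∀ f → x + y < f → isPFuel f x y ≡ true ⇔ K x y
  isPFuel⇔K {x} {y} (suc f) x+y<1+f with absorbing x y
  ... | inj₁ kxy = mk⇔ (λ _ → kxy) (λ _ → cong not (¬-not (no-move-to-P ∘ Equivalence.from T-≡)))
    where
    no-move-to-P : ¬ T (any (λ { (x′ , y′) → isPFuel f x′ y′ }) (moves x y))
    no-move-to-P some with (x′ , y′) , mem , isP′ ← find (any⁻ _ (moves x y) some)
      with ne , reach ← moves-sound mem =
      ne (independent kxy (Equivalence.to (isPFuel⇔K f (<-≤-trans (decreasing kxy reach ne) (m<1+n⇒m≤n x+y<1+f)))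
                                          (Equivalence.to T-≡ isP′)) reach)
  ... | inj₂ (x′ , y′ , k′ , reach , x′+y′<x+y) = mk⇔
    (λ isP → contradiction (trans (sym isP) (cong not (Equivalence.to T-≡ (any⁺ _ (lose (moves-complete reach ne) isP′))))) λ ())
    (λ kxy → ⊥-elim (ne (independent kxy k′ reach)))
    where
    ne : (x′ , y′) ≢ (x , y)
    ne refl = <-irrefl refl x′+y′<x+y
    isP′ : T (isPFuel f x′ y′)
    isP′ = Equivalence.from T-≡ (Equivalence.from (isPFuel⇔K f (<-≤-trans x′+y′<x+y (m<1+n⇒m≤n x+y<1+f))) k′)

  IsP⇔K : IsP x y ⇔ K x y
  IsP⇔K = isPFuel⇔K _ ≤-refl

-- Mex-recursive pairs

record MexRecursive (a b : ℕ → ℕ) : Set where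
  field
    initial : a 0 ≡ 0 × b 0 ≡ 0
    step    : ∀ n → IsMex (AB a b n) (a (suc n)) × IsMex₂ (DS a b n) (b (suc n) ∸ a (suc n))

AB-mono : ∀ {a b} → m ≤ n → AB a b m k → AB a b n k
AB-mono m≤n (i , i≤m , hit) = i , ≤-trans i≤m m≤n , hit

DS-mono : ∀ {a b} → m ≤ n → DS a b m k → DS a b n k
DS-mono m≤n (i , i≤m , hit) = i , ≤-trans i≤m m≤n , hit

module _ {S S′ : ℕ → Set} (S⊆S′ : ∀ k → S k → S′ k) (S′⊆S : ∀ k → S′ k → S k) where

  IsMex-resp : IsMex S m → IsMex S′ m
  IsMex-resp (fresh , below) = fresh ∘ S′⊆S _ , λ k k<m → S⊆S′ k (below k k<m)

  IsMex₂-resp : IsMex₂ S m → IsMex₂ S′ m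
  IsMex₂-resp (even , fresh , below) = even , fresh ∘ S′⊆S _ , λ k ek k<m → S⊆S′ k (below k ek k<m)

module _ {a a′ b b′ : ℕ → ℕ} (a≗a′ : ∀ n → a n ≡ a′ n) (b≗b′ : ∀ n → b n ≡ b′ n) where

  AB-≗ : AB a b n k → AB a′ b′ n k
  AB-≗ (i , i≤n , inj₁ k≡a) = i , i≤n , inj₁ (trans k≡a (a≗a′ i))
  AB-≗ (i , i≤n , inj₂ k≡b) = i , i≤n , inj₂ (trans k≡b (b≗b′ i))

  DS-≗ : DS a b n k → DS a′ b′ n k
  DS-≗ (i , i≤n , inj₁ k≡d) = i , i≤n , inj₁ (trans k≡d (cong₂ _∸_ (b≗b′ i) (a≗a′ i)))
  DS-≗ (i , i≤n , inj₂ k≡s) = i , i≤n , inj₂ (trans k≡s (cong₂ _+_ (a≗a′ i) (b≗b′ i)))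

MexRecursive-resp : ∀ {a a′ b b′} → (∀ n → a n ≡ a′ n) → (∀ n → b n ≡ b′ n) → MexRecursive a b → MexRecursive a′ b′
MexRecursive-resp {a} {a′} {b} {b′} a≗a′ b≗b′ rec = record
  { initial = trans (sym (a≗a′ 0)) (proj₁ initial) , trans (sym (b≗b′ 0)) (proj₂ initial)
  ; step    = λ n → subst (IsMex (AB a′ b′ n)) (a≗a′ (suc n))
                      (IsMex-resp (λ _ → AB-≗ a≗a′ b≗b′) (λ _ → AB-≗ (sym ∘ a≗a′) (sym ∘ b≗b′)) (proj₁ (step n)))
                  , subst (IsMex₂ (DS a′ b′ n)) (cong₂ _∸_ (b≗b′ (suc n)) (a≗a′ (suc n)))
                      (IsMex₂-resp (λ _ → DS-≗ a≗a′ b≗b′) (λ _ → DS-≗ (sym ∘ a≗a′) (sym ∘ b≗b′)) (proj₂ (step n)))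
  }
  where open MexRecursive rec

module MexRecursiveProperties {a b : ℕ → ℕ} (rec : MexRecursive a b) where
  open MexRecursive rec

  d : ℕ → ℕ
  d n = b n ∸ a n

  a₀ : a 0 ≡ 0
  a₀ = proj₁ initial

  b₀ : b 0 ≡ 0
  b₀ = proj₂ initial

  d₀ : d 0 ≡ 0
  d₀ = cong₂ _∸_ b₀ a₀

  a-fresh : ¬ AB a b n (a (suc n))
  a-fresh {n} = proj₁ (proj₁ (step n))

  a-below : k < a (suc n) → AB a b n k
  a-below {k} {n} = proj₂ (proj₁ (step n)) k

  d-fresh : ¬ DS a b n (d (suc n))
  d-fresh {n} = proj₁ (proj₂ (proj₂ (step n)))

  d-below : Even k → k < d (suc n) → DS a b n k
  d-below {k} {n} = proj₂ (proj₂ (proj₂ (step n))) k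

  d-even : ∀ n → Even (d n)
  d-even zero    = subst Even (sym d₀) refl
  d-even (suc n) = proj₁ (proj₂ (step n))

  AB-≤a : k ≤ a n → AB a b n k
  AB-≤a {k} {zero} k≤a₀ = 0 , z≤n , inj₁ (trans (n≤0⇒n≡0 (subst (k ≤_) a₀ k≤a₀)) (sym a₀))
  AB-≤a {n = suc n} k≤a with m≤n⇒m<n∨m≡n k≤a
  ... | inj₁ k<a  = AB-mono {a = a} {b} (n≤1+n n) (a-below k<a)
  ... | inj₂ refl = suc n , ≤-refl , inj₁ refl

  DS-≤d : Even k → k ≤ d n → DS a b n k
  DS-≤d {k} {zero} _ k≤d₀ = 0 , z≤n , inj₁ (trans (n≤0⇒n≡0 (subst (k ≤_) d₀ k≤d₀)) (sym d₀))
  DS-≤d {n = suc n} ek k≤d with m≤n⇒m<n∨m≡n k≤d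
  ... | inj₁ k<d  = DS-mono {a = a} {b} (n≤1+n n) (d-below ek k<d)
  ... | inj₂ refl = suc n , ≤-refl , inj₁ refl

  a-increasing : StrictlyIncreasing a
  a-increasing n = ≰⇒> (a-fresh ∘ AB-≤a)

  d-increasing : StrictlyIncreasing d
  d-increasing n = ≰⇒> (d-fresh ∘ DS-≤d (d-even (suc n)))

  a≤b : ∀ n → a n ≤ b n
  a≤b zero    = subst (_≤ b 0) (sym a₀) z≤n
  a≤b (suc n) = <⇒≤ (m∸n≢0⇒n<m λ d≡0 → d-fresh (0 , z≤n , inj₁ (trans d≡0 (sym d₀))))

  b≡a+d : ∀ n → b n ≡ a n + d n
  b≡a+d n = sym (m+[n∸m]≡n (a≤b n))

  b-increasing : StrictlyIncreasing b
  b-increasing n = subst₂ _<_ (sym (b≡a+d n)) (sym (b≡a+d (suc n))) (+-mono-< (a-increasing n) (d-increasing n))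

  a-positive : 0 < a (suc n)
  a-positive {n} = subst (_< a (suc n)) a₀ (increasing-< a-increasing z<s)

  covers : ∀ k → ∃[ i ] (k ≡ a i ⊎ k ≡ b i)
  covers k with i , _ , hit ← a-below (increasing-≥-id a-increasing (suc k)) = i , hit

  a≢earlier-b : i < j → a j ≢ b i
  a≢earlier-b {i} {suc j} i<1+j aj≡bi = a-fresh (i , m<1+n⇒m≤n i<1+j , inj₂ aj≡bi)

  d≢earlier-sum : i < j → d j ≢ a i + b i
  d≢earlier-sum {i} {suc j} i<1+j dj≡sum = d-fresh (i , m<1+n⇒m≤n i<1+j , inj₂ dj≡sum)

  a≡b⇒≡0 : a j ≡ b i → i ≡ 0 × j ≡ 0
  a≡b⇒≡0 {j} {i} aj≡bi with i <? j
  ... | yes i<j = contradiction aj≡bi (a≢earlier-b i<j)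
  ... | no  i≮j = i≡0 , n≤0⇒n≡0 (subst (j ≤_) i≡0 j≤i)
    where
    j≤i = ≮⇒≥ i≮j
    i≡0 : i ≡ 0
    i≡0 = increasing-injective d-increasing
            (trans (m≤n⇒m∸n≡0 (subst (_≤ a i) aj≡bi (increasing-≤ a-increasing j≤i))) (sym d₀))

  d≡sum⇒≡0 : d j ≡ a i + b i → i ≡ 0 × j ≡ 0
  d≡sum⇒≡0 {j} {i} dj≡sum with i <? j
  ... | yes i<j = contradiction dj≡sum (d≢earlier-sum i<j)
  ... | no  i≮j = i≡0 , n≤0⇒n≡0 (subst (j ≤_) i≡0 j≤i)
    where
    open ≤-Reasoning
    j≤i = ≮⇒≥ i≮j
    ai+ai≡0 : a i + a i ≡ 0
    ai+ai≡0 = m+n≤n⇒m≡0 (a i + a i) (d i) (begin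
      a i + a i + d i   ≡⟨ +-assoc (a i) (a i) (d i) ⟩
      a i + (a i + d i) ≡⟨ cong (a i +_) (b≡a+d i) ⟨
      a i + b i         ≡⟨ dj≡sum ⟨
      d j               ≤⟨ increasing-≤ d-increasing j≤i ⟩
      d i               ∎)
    i≡0 : i ≡ 0
    i≡0 = increasing-injective a-increasing (trans (m+n≡0⇒m≡0 (a i) ai+ai≡0) (sym a₀))

  data Kernel (x y : ℕ) : Set where
    upper : ∀ i → x ≡ a i → y ≡ b i → Kernel x y
    lower : ∀ i → x ≡ b i → y ≡ a i → Kernel x y

  Kernel-swap : Kernel x y → Kernel y x
  Kernel-swap (upper i x≡a y≡b) = lower i y≡b x≡a
  Kernel-swap (lower i x≡b y≡a) = upper i y≡a x≡b

  Kernel-partner : Kernel x y → Kernel x y′ → y ≡ y′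
  Kernel-partner (upper i refl refl) (upper j ai≡aj refl) = cong b (increasing-injective a-increasing ai≡aj)
  Kernel-partner (upper i refl refl) (lower j ai≡bj refl) with refl , refl ← a≡b⇒≡0 ai≡bj = trans b₀ (sym a₀)
  Kernel-partner (lower i refl refl) (upper j bi≡aj refl) with refl , refl ← a≡b⇒≡0 (sym bi≡aj) = trans a₀ (sym b₀)
  Kernel-partner (lower i refl refl) (lower j bi≡bj refl) = cong a (increasing-injective b-increasing bi≡bj)

  Kernel-origin : Kernel x x → x ≡ 0
  Kernel-origin (upper i refl ai≡bi) with refl , refl ← a≡b⇒≡0 ai≡bi = a₀
  Kernel-origin (lower i refl bi≡ai) with refl , refl ← a≡b⇒≡0 (sym bi≡ai) = b₀

  Kernel-sum : Kernel x y → ∃[ i ] x + y ≡ a i + b i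
  Kernel-sum (upper i refl refl) = i , refl
  Kernel-sum (lower i refl refl) = i , +-comm (b i) (a i)

  Kernel-even : Kernel x y → parity (x + y) ≡ 0ℙ
  Kernel-even {x} {y} k with i , x+y≡ ← Kernel-sum k = begin
    parity (x + y)               ≡⟨ cong parity (trans x+y≡ (cong (a i +_) (b≡a+d i))) ⟩
    parity (a i + (a i + d i))   ≡⟨ cong parity (+-comm.x∙yz≈z∙xy (a i) (a i) (d i)) ⟩
    parity (d i + (a i + a i))   ≡⟨ parity-+-double (d i) (a i) ⟩
    parity (d i)                 ≡⟨ even⇒parity≡0ℙ (d i) (d-even i) ⟩
    0ℙ                           ∎
    where open ≡-Reasoning

  d≡0⇒≡0 : d i ≡ 0 → i ≡ 0
  d≡0⇒≡0 di≡0 = increasing-injective d-increasing (trans di≡0 (sym d₀))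

  diagonal-from-upper : ∀ i → Kernel x′ y′ → x′ + b i ≡ y′ + a i → x′ ≡ a i
  diagonal-from-upper i (upper j refl refl) eq =
    cong a (sym (increasing-injective d-increasing
      (+-cancel-shifted (a j) (a i) (d i) (d j) (subst₂ (λ p q → a j + p ≡ q + a i) (b≡a+d i) (b≡a+d j) eq))))
  diagonal-from-upper i (lower j refl refl) eq =
    both-zero (+-cancel-excess (a j) (a i) (d j) (d i) (subst₂ (λ p q → p + q ≡ a j + a i) (b≡a+d j) (b≡a+d i) eq))
    where
    both-zero : d j + d i ≡ 0 → b j ≡ a i
    both-zero excess with refl ← d≡0⇒≡0 {j} (m+n≡0⇒m≡0 (d j) excess) | refl ← d≡0⇒≡0 {i} (m+n≡0⇒n≡0 (d j) excess) =
      trans b₀ (sym a₀)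

  Kernel-diagonal : Kernel x y → Kernel x′ y′ → x′ + y ≡ y′ + x → x′ ≡ x
  Kernel-diagonal (upper i refl refl) k′ eq = diagonal-from-upper i k′ eq
  Kernel-diagonal {x} {y} {x′} {y′} (lower i refl refl) k′ eq =
    +-cancelʳ-≡ y x′ x (trans eq (trans (cong (_+ x) y′≡y) (+-comm y x)))
    where
    y′≡y : y′ ≡ y
    y′≡y = diagonal-from-upper i (Kernel-swap k′) (sym eq)

  Kernel-reflect : Kernel x y → Kernel x′ y′ → x′ + y′ + x ≡ y → x ≡ y
  Kernel-reflect {x′ = x′} {y′} (upper i refl refl) k′ eq = from-sum (Kernel-sum k′)
    where
    reflected : x′ + y′ ≡ d i
    reflected = +-cancelʳ-≡ (a i) (x′ + y′) (d i) (trans eq (trans (b≡a+d i) (+-comm (a i) (d i))))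
    from-sum : ∃[ j ] x′ + y′ ≡ a j + b j → a i ≡ b i
    from-sum (j , sum′) with refl , refl ← d≡sum⇒≡0 {i} {j} (trans (sym reflected) sum′) = trans a₀ (sym b₀)
  Kernel-reflect {x′ = x′} {y′} (lower i refl refl) k′ eq =
    ≤-antisym (subst (b i ≤_) eq (m≤n+m (b i) (x′ + y′))) (a≤b i)

  reflect-into-kernel : Kernel x y → Kernel x′ y′ → x′ + y′ + x ≡ y → (x′ , y′) ≡ (x , y)
  reflect-into-kernel {x} {y} {x′} {y′} k k′ eq
    with refl ← Kernel-reflect k k′ eq
    with refl ← Kernel-origin k =
    cong₂ _,_ (m+n≡0⇒m≡0 x′ x′+y′≡0) (m+n≡0⇒n≡0 x′ x′+y′≡0)
    where
    x′+y′≡0 : x′ + y′ ≡ 0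
    x′+y′≡0 = trans (sym (+-identityʳ (x′ + y′))) eq

  shifted-launch-parity : Kernel x′ y′ → Glide u v x′ y′ → parity (suc (u + v)) ≢ 0ℙ
  shifted-launch-parity {x′} {y′} {u} {v} k′ glide p≡0 = ℙ.p≢p⁻¹ 0ℙ (begin
    0ℙ                      ≡⟨ p≡0 ⟨
    parity (suc (u + v))    ≡⟨ parity-suc (u + v) ⟩
    parity (u + v) ⁻¹       ≡⟨ cong _⁻¹ (Glide-parity glide) ⟩
    parity (x′ + y′) ⁻¹     ≡⟨ cong _⁻¹ (Kernel-even k′) ⟩
    0ℙ ⁻¹                   ∎)
    where open ≡-Reasoning

  Kernel-independent : Kernel x y → Kernel x′ y′ → Reach x y x′ y′ → (x′ , y′) ≡ (x , y)
  Kernel-independent k k′ (rookˡ x′<x) =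
    contradiction (Kernel-partner (Kernel-swap k) (Kernel-swap k′)) (<⇒≢ x′<x ∘ sym)
  Kernel-independent k k′ (rookᵇ y′<y) =
    contradiction (Kernel-partner k k′) (<⇒≢ y′<y ∘ sym)
  Kernel-independent {x′ = x′} {y′} k k′ (queen stay (diagonal s refl refl))
    with refl ← +-cancelˡ-≡ x′ s 0 (trans (sym (Kernel-diagonal k k′ (+-comm.x∙yz≈y∙xz x′ y′ s))) (sym (+-identityʳ x′))) =
    sym (cong₂ _,_ (+-identityʳ x′) (+-identityʳ y′))
  Kernel-independent k k′ (queen stay (reflectˡ eq)) = reflect-into-kernel k k′ eq
  Kernel-independent {x} {y} {x′} {y′} k k′ (queen stay (reflectᵇ eq)) =
    cong swap (reflect-into-kernel (Kernel-swap k) (Kernel-swap k′) (trans (cong (_+ y) (+-comm y′ x′)) eq))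
  Kernel-independent k k′ (queen left glide) = contradiction (Kernel-even k) (shifted-launch-parity k′ glide)
  Kernel-independent {x} {suc v} k k′ (queen down glide) =
    contradiction (trans (sym (cong parity (+-suc x v))) (Kernel-even k)) (shifted-launch-parity k′ glide)

  Kernel-positive : Kernel x y → (x ≡ 0 × y ≡ 0) ⊎ (0 < x × 0 < y)
  Kernel-positive (upper zero refl refl)    = inj₁ (a₀ , b₀)
  Kernel-positive (upper (suc n) refl refl) = inj₂ (a-positive , <-≤-trans a-positive (a≤b (suc n)))
  Kernel-positive (lower zero refl refl)    = inj₁ (b₀ , a₀)
  Kernel-positive (lower (suc n) refl refl) = inj₂ (<-≤-trans a-positive (a≤b (suc n)) , a-positive)

  Kernel-decreasing : Kernel x y → Reach x y x′ y′ → (x′ , y′) ≢ (x , y) → x′ + y′ < x + y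
  Kernel-decreasing k reach ne with Kernel-positive k
  ... | inj₁ (refl , refl) = contradiction (Reach-origin reach) ne
  ... | inj₂ (0<x , 0<y)   = Reach-decreasing 0<x 0<y reach ne

  glide-into-Kernel : Launch x y (a (suc n)) (a (suc n) + δ) → DS a b n δ → MovesInto Kernel x y
  glide-into-Kernel {x} {y} {n} {δ} launch (j , j≤n , hit) = from-glide (target hit)
    where
    c = a (suc n)
    aj<c : a j < c
    aj<c = increasing-< a-increasing (s≤s j≤n)
    target : δ ≡ b j ∸ a j ⊎ δ ≡ a j + b j → ∃₂ λ x′ y′ → Kernel x′ y′ × Glide c (c + δ) x′ y′ × x′ + y′ < c + (c + δ)
    target (inj₁ δ≡dj) = a j , b j , upper j refl refl
      , diagonal (c ∸ a j) (m+[n∸m]≡n (<⇒≤ aj<c))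
          (trans (cong (_+ (c ∸ a j)) bj≡aj+δ) (trans (+-comm.xy∙z≈xz∙y (a j) δ (c ∸ a j)) (cong (_+ δ) (m+[n∸m]≡n (<⇒≤ aj<c)))))
      , +-mono-< aj<c (subst (_< c + δ) (sym bj≡aj+δ) (+-monoˡ-< δ aj<c))
      where
      bj≡aj+δ : b j ≡ a j + δ
      bj≡aj+δ = trans (b≡a+d j) (cong (a j +_) (sym δ≡dj))
    target (inj₂ δ≡sum) = a j , b j , upper j refl refl
      , reflectˡ (trans (cong (_+ c) (sym δ≡sum)) (+-comm δ c))
      , subst (_< c + (c + δ)) δ≡sum (<-≤-trans (m<n+m δ a-positive) (m≤n+m (c + δ) c))
    from-glide : ∃₂ (λ x′ y′ → Kernel x′ y′ × Glide c (c + δ) x′ y′ × x′ + y′ < c + (c + δ)) → MovesInto Kernel x y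
    from-glide (x′ , y′ , k′ , glide , x′+y′<) =
      x′ , y′ , k′ , queen launch glide , <-≤-trans x′+y′< (+-mono-≤ (proj₁ (Launch-≤ launch)) (proj₂ (Launch-≤ launch)))

  short-of-partner : ∀ i → a i ≤ y → y < b i → MovesInto Kernel (a i) y
  short-of-partner zero _ y<b₀ = contradiction (subst (_ <_) b₀ y<b₀) λ ()
  short-of-partner {y} (suc n) c≤y y<b = by-parity (even⊎odd g)
    where
    c = a (suc n)
    g = y ∸ c
    y≡c+g : y ≡ c + g
    y≡c+g = sym (m+[n∸m]≡n c≤y)
    g<d : g < d (suc n)
    g<d = +-cancelˡ-< c g (d (suc n)) (subst₂ _<_ y≡c+g (b≡a+d (suc n)) y<b)
    by-parity : Even g ⊎ ∃[ g′ ] (g ≡ suc g′ × Even g′) → MovesInto Kernel c y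
    by-parity (inj₁ even-g) = glide-into-Kernel (subst (Launch c y c) y≡c+g stay) (d-below even-g g<d)
    by-parity (inj₂ (g′ , g≡1+g′ , even-g′)) =
      glide-into-Kernel (subst (λ w → Launch c w c (c + g′)) (sym y≡1+c+g′) down)
        (d-below even-g′ (<-trans (subst (g′ <_) (sym g≡1+g′) (n<1+n g′)) g<d))
      where
      y≡1+c+g′ : y ≡ suc (c + g′)
      y≡1+c+g′ = trans y≡c+g (trans (cong (c +_) g≡1+g′) (+-suc c g′))

  absorbing-≤ : x ≤ y → Kernel x y ⊎ MovesInto Kernel x y
  absorbing-≤ {x} {y} x≤y with covers x
  ... | i , inj₂ refl with a i <? y
  ...   | yes ai<y = inj₂ (b i , a i , lower i refl refl , rookᵇ ai<y , +-monoʳ-< (b i) ai<y)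
  ...   | no  ai≮y = inj₁ (lower i refl (≤-antisym (≮⇒≥ ai≮y) (≤-trans (a≤b i) x≤y)))
  absorbing-≤ {x} {y} x≤y | i , inj₁ refl with <-cmp y (b i)
  ...   | tri< y<bi _ _ = inj₂ (short-of-partner i x≤y y<bi)
  ...   | tri≈ _ refl _ = inj₁ (upper i refl refl)
  ...   | tri> _ _ bi<y = inj₂ (a i , b i , upper i refl refl , rookᵇ bi<y , +-monoʳ-< (a i) bi<y)

  Kernel-absorbing : ∀ x y → Kernel x y ⊎ MovesInto Kernel x y
  Kernel-absorbing x y with ≤-total x y
  ... | inj₁ x≤y = absorbing-≤ x≤y
  ... | inj₂ y≤x with absorbing-≤ y≤x
  ...   | inj₁ k     = inj₁ (Kernel-swap k)
  ...   | inj₂ moves = inj₂ (MovesInto-swap Kernel-swap moves)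

  IsP⇔Kernel : IsP x y ⇔ Kernel x y
  IsP⇔Kernel = KernelCharacterisation.IsP⇔K Kernel Kernel-independent Kernel-absorbing Kernel-decreasing

  enumeration-unique : ∀ {a′ b′} → IsEnumeration a′ b′ → (∀ n → a′ n ≡ a n) × (∀ n → b′ n ≡ b n)
  enumeration-unique {a′} {b′} ((a′₀ , b′₀) , isP , complete , increasing) = a′≗a , b′≗b
    where
    a′-increasing : StrictlyIncreasing a′
    a′-increasing zero    = subst (_< a′ 1) (sym a′₀) (proj₁ (proj₂ (isP 1 (s≤s z≤n))))
    a′-increasing (suc n) = increasing (suc n) (s≤s z≤n)

    a′⊆a : ∀ n → ∃[ m ] a m ≡ a′ n
    a′⊆a zero = 0 , trans a₀ (sym a′₀)
    a′⊆a (suc n) with isP′ , _ , a′≤b′ ← isP (suc n) (s≤s z≤n) with Equivalence.to IsP⇔Kernel isP′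
    ... | upper i a′≡a _      = i , sym a′≡a
    ... | lower i a′≡b b′≡a = i , trans (≤-antisym (a≤b i) (subst₂ _≤_ a′≡b b′≡a a′≤b′)) (sym a′≡b)

    a⊆a′ : ∀ n → ∃[ m ] a′ m ≡ a n
    a⊆a′ zero = 0 , trans a′₀ (sym a₀)
    a⊆a′ (suc n) with m , _ , a′m≡a , _ ←
      complete (a (suc n)) (b (suc n)) (Equivalence.from IsP⇔Kernel (upper (suc n) refl refl)) a-positive (a≤b (suc n)) =
      m , a′m≡a

    a′≗a : ∀ n → a′ n ≡ a n
    a′≗a = increasing-same-image⇒≗ a′-increasing a-increasing a′⊆a a⊆a′

    b′≗b : ∀ n → b′ n ≡ b n
    b′≗b zero    = trans b′₀ (sym b₀)
    b′≗b (suc n) = Kernel-partner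
      (subst (λ z → Kernel z (b′ (suc n))) (a′≗a (suc n)) (Equivalence.to IsP⇔Kernel (proj₁ (isP (suc n) (s≤s z≤n)))))
      (upper (suc n) refl refl)

-- Existence of a mex-recursive pair

Occurs : (Pos → ℕ) → (Pos → ℕ) → List Pos → ℕ → Set
Occurs f g ps k = Any (λ p → k ≡ f p ⊎ k ≡ g p) ps

module _ (f g : Pos → ℕ) where

  occurs? : ∀ ps → Decidable (Occurs f g ps)
  occurs? ps k = any? (λ p → (k ≟ f p) ⊎-dec (k ≟ g p)) ps

  weight : List Pos → ℕ
  weight = foldr (λ p w → f p + g p + w) 0

  Occurs-≤ : ∀ {ps} → Occurs f g ps k → k ≤ weight ps
  Occurs-≤ {ps = p ∷ ps} (here (inj₁ refl)) = ≤-trans (m≤m+n (f p) (g p)) (m≤m+n _ (weight ps))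
  Occurs-≤ {ps = p ∷ ps} (here (inj₂ refl)) = ≤-trans (m≤n+m (g p) (f p)) (m≤m+n _ (weight ps))
  Occurs-≤ {ps = p ∷ ps} (there occ)        = ≤-trans (Occurs-≤ occ) (m≤n+m (weight ps) _)

  mexOf : ∀ ps → ∃ (IsMex (Occurs f g ps))
  mexOf ps = mex-exists (occurs? ps) (λ occ → <-irrefl refl (Occurs-≤ occ))

  mex₂Of : ∀ ps → ∃ (IsMex₂ (Occurs f g ps))
  mex₂Of ps = mex₂-exists (occurs? ps) (m*n%n≡0 (suc (weight ps)) 2)
    (λ occ → <-irrefl refl (≤-trans (m≤m*n (suc (weight ps)) 2) (Occurs-≤ occ)))

history : ℕ → List Pos
history zero    = (0 , 0) ∷ []
history (suc n) = (c , c + e) ∷ history n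
  where
  c = proj₁ (mexOf proj₁ proj₂ (history n))
  e = proj₁ (mex₂Of (λ p → proj₂ p ∸ proj₁ p) (λ p → proj₁ p + proj₂ p) (history n))

newest : List Pos → Pos
newest []      = 0 , 0
newest (p ∷ _) = p

α β : ℕ → ℕ
α n = proj₁ (newest (history n))
β n = proj₂ (newest (history n))

Any-history⁻ : ∀ {P : Pos → Set} n → Any P (history n) → ∃[ i ] (i ≤ n × P (newest (history i)))
Any-history⁻ zero    (here p)  = 0 , z≤n , p
Any-history⁻ (suc n) (here p)  = suc n , ≤-refl , p
Any-history⁻ (suc n) (there q) with i , i≤n , p ← Any-history⁻ n q = i , m≤n⇒m≤1+n i≤n , p

Any-history⁺ : ∀ {P : Pos → Set} n → ∃[ i ] (i ≤ n × P (newest (history i))) → Any P (history n)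
Any-history⁺ zero    (zero , _ , p) = here p
Any-history⁺ (suc n) (i , i≤1+n , p) with m≤n⇒m<n∨m≡n i≤1+n
... | inj₁ i<1+n = there (Any-history⁺ n (i , m<1+n⇒m≤n i<1+n , p))
... | inj₂ refl  = here p

αβ-mexRecursive : MexRecursive α β
αβ-mexRecursive = record
  { initial = refl , refl
  ; step    = λ n →
      IsMex-resp (λ _ → Any-history⁻ n) (λ _ → Any-history⁺ n) (proj₂ (mexOf proj₁ proj₂ (history n)))
      , subst (IsMex₂ (DS α β n)) (sym (m+n∸m≡n (α (suc n)) _))
          (IsMex₂-resp (λ _ → Any-history⁻ n) (λ _ → Any-history⁺ n)
            (proj₂ (mex₂Of (λ p → proj₂ p ∸ proj₁ p) (λ p → proj₁ p + proj₂ p) (history n))))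
  }

lemma2 : (a b : ℕ → ℕ) → IsEnumeration a b →
    ∀ n → IsMex (AB a b n) (a (suc n)) × IsMex₂ (DS a b n) (b (suc n) ∸ a (suc n))
lemma2 a b enum = MexRecursive.step (MexRecursive-resp (sym ∘ a≗α) (sym ∘ b≗β) αβ-mexRecursive)
  where
  open MexRecursiveProperties αβ-mexRecursive using (enumeration-unique)
  a≗α = proj₁ (enumeration-unique enum)
  b≗β = proj₂ (enumeration-unique enum)
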